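{- Let $f:\{ -1,1\}^n\to\{ -1,1\}$ be computed by a decision tree $T$ whose root queries $x_i$, and let $g$ and $h$ be the functions computed by the left ($x_i=1$) and right ($x_i=-1$) subtrees. Then $\mathbf{I}_i[f]\ge\tfrac12\mathrm{Var}[f]-\tfrac12\mathrm{Cov}[g,h]$.
   Context: All probabilities and expectations are under the uniform distribution on $\{ -1,1\}^n$. $\mathbf{I}_i[f]=\Pr_x[f(x)\ne f(x^{\oplus i})]$; $\mathrm{Cov}[g,h]=\mathbb{E}[(g-\mathbb{E}g)(h-\mathbb{E}h)]$. Decision trees query no variable twice along a root-to-leaf path. -}

module Defs where

open import Data.Bool using (Bool; true; false; not; _xor_; if_then_else_)
open import Data.Nat using (ℕ; zero; suc)
open import Data.Fin using (Fin)
open import Data.Vec using (Vec; []; _∷_; updateAt)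
open import Data.Rational using (ℚ; 0ℚ; 1ℚ; ½; _+_; _*_; _-_; -_)
open import Data.Empty using (⊥)
open import Data.Product using (_×_)
open import Relation.Nullary using (¬_)

-- Points of {-1,1}^n : true encodes +1, false encodes -1.
Cube : ℕ → Set
Cube n = Vec Bool n

BoolFun : ℕ → Set
BoolFun n = Cube n → Bool

val : Bool → ℚ
val true  = 1ℚ
val false = - 1ℚ

E : (n : ℕ) → (Cube n → ℚ) → ℚ
E zero    F = F []
E (suc n) F = ½ * (E n (λ x → F (true ∷ x)) + E n (λ x → F (false ∷ x)))

Pr : (n : ℕ) → (Cube n → Bool) → ℚ
Pr n P = E n (λ x → if P x then 1ℚ else 0ℚ)

flipAt : {n : ℕ} → Fin n → Cube n → Cube n
flipAt i x = updateAt x i not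

Inf : (n : ℕ) → Fin n → BoolFun n → ℚ
Inf n i f = Pr n (λ x → f x xor f (flipAt i x))

real : {n : ℕ} → BoolFun n → Cube n → ℚ
real f x = val (f x)

Cov : (n : ℕ) → BoolFun n → BoolFun n → ℚ
Cov n g h = E n (λ x → (real g x - E n (real g)) * (real h x - E n (real h)))

Var : (n : ℕ) → BoolFun n → ℚ
Var n f = Cov n f f

-- Decision trees over variables x_0..x_{n-1}.
-- node i l r queries x_i; l is followed when x_i = 1 (true), r when x_i = -1 (false).
data DT (n : ℕ) : Set where
  leaf : Bool → DT n
  node : Fin n → DT n → DT n → DT n

eval : {n : ℕ} → DT n → BoolFun n
eval (leaf b)     x = b
eval (node i l r) x = if Data.Vec.lookup x i then eval l x else eval r x

data Queries {n : ℕ} (i : Fin n) : DT n → Set where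
  here  : ∀ {l r} → Queries i (node i l r)
  left  : ∀ {j l r} → Queries i l → Queries i (node j l r)
  right : ∀ {j l r} → Queries i r → Queries i (node j l r)

data Valid {n : ℕ} : DT n → Set where
  leaf : ∀ {b} → Valid (leaf b)
  node : ∀ {i l r} → ¬ Queries i l → ¬ Queries i r → Valid l → Valid r → Valid (node i l r)

module Submission where

-- Write a = E[g], b = E[h], c = E[g·h] (in ±1 values).  Because no path
-- queries x_i twice, neither subtree depends on x_i, so conditioning on
-- the root variable gives
--   E[f] = ½(a + b),   I_i[f] = Pr[g ≠ h] = ½ − ½c,
-- while for any ±1-valued functions Var[f] = 1 − E[f]² and
-- Cov[g,h] = c − ab.  The claim then reduces to the arithmetic fact
--   ½(1 − ((a+b)/2)²) − ½(c − ab) + ½((a−b)/2)² = ½ − ½c.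

open import Defs
open import Data.Nat using (ℕ; zero; suc)
open import Data.Fin using (Fin)
import Data.Fin.Properties as FinP
open import Data.Bool using (Bool; true; false; not; _xor_; if_then_else_)
open import Data.Bool.Properties using (xor-comm)
open import Data.Vec using ([]; _∷_; _[_]≔_)
open import Data.Vec.Properties using (lookup∘update; lookup∘update′; updateAt-updateAt)
open import Data.Rational using (ℚ; ½; _*_; _-_; _≤_; _+_; -_; 0ℚ; 1ℚ; nonNegative; nonPositive)
import Data.Rational.Properties as ℚP
open import Data.Rational.Solver using (module +-*-Solver)
open +-*-Solver
open import Data.Empty using (⊥-elim)
open import Data.Sum using (inj₁; inj₂)
open import Relation.Nullary using (¬_; yes; no)
open import Relation.Binary.PropositionalEquality

E-cong : ∀ n {F G : Cube n → ℚ} → (∀ x → F x ≡ G x) → E n F ≡ E n G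
E-cong zero    F≗G = F≗G []
E-cong (suc n) F≗G =
  cong₂ (λ u v → ½ * (u + v)) (E-cong n (λ x → F≗G (true ∷ x))) (E-cong n (λ x → F≗G (false ∷ x)))

average-self : ∀ p → ½ * (p + p) ≡ p
average-self = solve 1 (λ p → con ½ :* (p :+ p) := p) refl

E-const : ∀ n (c : ℚ) → E n (λ _ → c) ≡ c
E-const zero    c = refl
E-const (suc n) c rewrite E-const n c = average-self c

E-add : ∀ n (F G : Cube n → ℚ) → E n (λ x → F x + G x) ≡ E n F + E n G
E-add zero    F G = refl
E-add (suc n) F G
  rewrite E-add n (λ x → F (true ∷ x)) (λ x → G (true ∷ x))
        | E-add n (λ x → F (false ∷ x)) (λ x → G (false ∷ x)) =
  solve 4 (λ p q r s → con ½ :* ((p :+ r) :+ (q :+ s)) := con ½ :* (p :+ q) :+ con ½ :* (r :+ s)) refl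
    (E n (λ x → F (true ∷ x))) (E n (λ x → F (false ∷ x)))
    (E n (λ x → G (true ∷ x))) (E n (λ x → G (false ∷ x)))

E-scale : ∀ n (d : ℚ) (F : Cube n → ℚ) → E n (λ x → d * F x) ≡ d * E n F
E-scale zero    d F = refl
E-scale (suc n) d F
  rewrite E-scale n d (λ x → F (true ∷ x)) | E-scale n d (λ x → F (false ∷ x)) =
  solve 3 (λ d p q → con ½ :* (d :* p :+ d :* q) := d :* (con ½ :* (p :+ q))) refl
    d (E n (λ x → F (true ∷ x))) (E n (λ x → F (false ∷ x)))

E-affine : ∀ n (c d : ℚ) (F : Cube n → ℚ) → E n (λ x → c + d * F x) ≡ c + d * E n F
E-affine n c d F =
  trans (E-add n (λ _ → c) (λ x → d * F x)) (cong₂ _+_ (E-const n c) (E-scale n d F))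

E-centred-product : ∀ n (F G : Cube n → ℚ) →
  E n (λ x → (F x - E n F) * (G x - E n G)) ≡ E n (λ x → F x * G x) - E n F * E n G
E-centred-product n F G = begin
  E n (λ x → (F x - a) * (G x - b))
    ≡⟨ E-cong n expand ⟩
  E n (λ x → (a * b + (- b) * F x) + ((- a) * G x + F x * G x))
    ≡⟨ E-add n (λ x → a * b + (- b) * F x) (λ x → (- a) * G x + F x * G x) ⟩
  E n (λ x → a * b + (- b) * F x) + E n (λ x → (- a) * G x + F x * G x)
    ≡⟨ cong₂ _+_ (E-affine n (a * b) (- b) F) (E-add n (λ x → (- a) * G x) (λ x → F x * G x)) ⟩
  (a * b + (- b) * a) + (E n (λ x → (- a) * G x) + c)
    ≡⟨ cong (λ u → (a * b + (- b) * a) + (u + c)) (E-scale n (- a) G) ⟩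
  (a * b + (- b) * a) + ((- a) * b + c)
    ≡⟨ solve 3 (λ a b c → (a :* b :+ (:- b) :* a) :+ ((:- a) :* b :+ c) := c :- a :* b) refl a b c ⟩
  c - a * b ∎
  where
  open ≡-Reasoning
  a = E n F
  b = E n G
  c = E n (λ x → F x * G x)
  expand : ∀ x → (F x - a) * (G x - b) ≡ (a * b + (- b) * F x) + ((- a) * G x + F x * G x)
  expand x = solve 4 (λ u v a b → (u :- a) :* (v :- b) := (a :* b :+ (:- b) :* u) :+ ((:- a) :* v :+ u :* v))
               refl (F x) (G x) a b

val-square : ∀ β → val β * val β ≡ 1ℚ
val-square true  = refl
val-square false = refl

Var-boolean : ∀ n (f : BoolFun n) → Var n f ≡ 1ℚ - E n (real f) * E n (real f)
Var-boolean n f = trans (E-centred-product n (real f) (real f))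
  (cong (_- E n (real f) * E n (real f)) (trans (E-cong n (λ x → val-square (f x))) (E-const n 1ℚ)))

E-condition : ∀ n (i : Fin n) (F : Cube n → ℚ) →
  E n F ≡ ½ * (E n (λ x → F (x [ i ]≔ true)) + E n (λ x → F (x [ i ]≔ false)))
E-condition (suc n) Fin.zero F =
  sym (cong₂ (λ u v → ½ * (u + v)) (average-self (E n (λ x → F (true ∷ x))))
                                   (average-self (E n (λ x → F (false ∷ x)))))
E-condition (suc n) (Fin.suc i) F
  rewrite E-condition n i (λ x → F (true ∷ x)) | E-condition n i (λ x → F (false ∷ x)) =
  solve 4 (λ p q r s → con ½ :* (con ½ :* (p :+ q) :+ con ½ :* (r :+ s))
                       := con ½ :* (con ½ :* (p :+ r) :+ con ½ :* (q :+ s))) refl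
    (E n (λ x → F (true ∷ x [ i ]≔ true))) (E n (λ x → F (true ∷ x [ i ]≔ false)))
    (E n (λ x → F (false ∷ x [ i ]≔ true))) (E n (λ x → F (false ∷ x [ i ]≔ false)))

eval-ignores : ∀ {n} (i : Fin n) (T : DT n) → ¬ Queries i T →
  ∀ b x → eval T (x [ i ]≔ b) ≡ eval T x
eval-ignores i (leaf _)     _   b x = refl
eval-ignores i (node j l r) ¬iT b x with j FinP.≟ i
... | yes refl = ⊥-elim (¬iT here)
... | no j≢i rewrite lookup∘update′ j≢i x b
                   | eval-ignores i l (λ q → ¬iT (left q)) b x
                   | eval-ignores i r (λ q → ¬iT (right q)) b x = refl

root-true : ∀ {n} (i : Fin n) (L R : DT n) → ¬ Queries i L →
  ∀ x → eval (node i L R) (x [ i ]≔ true) ≡ eval L x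
root-true i L R ¬iL x rewrite lookup∘update i x true = eval-ignores i L ¬iL true x

root-false : ∀ {n} (i : Fin n) (L R : DT n) → ¬ Queries i R →
  ∀ x → eval (node i L R) (x [ i ]≔ false) ≡ eval R x
root-false i L R ¬iR x rewrite lookup∘update i x false = eval-ignores i R ¬iR false x

flip-fixed : ∀ {n} (i : Fin n) b (x : Cube n) → flipAt i (x [ i ]≔ b) ≡ x [ i ]≔ not b
flip-fixed i b x = updateAt-updateAt i x

E-root : ∀ n (i : Fin n) (L R : DT n) → Valid (node i L R) →
  E n (real (eval (node i L R))) ≡ ½ * (E n (real (eval L)) + E n (real (eval R)))
E-root n i L R (node ¬iL ¬iR _ _) = trans (E-condition n i (real (eval (node i L R))))
  (cong₂ (λ u v → ½ * (u + v)) (E-cong n (λ x → cong val (root-true i L R ¬iL x)))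
                               (E-cong n (λ x → cong val (root-false i L R ¬iR x))))

disagreement : ∀ p q → (if p xor q then 1ℚ else 0ℚ) ≡ ½ + (- ½) * (val p * val q)
disagreement true  true  = refl
disagreement true  false = refl
disagreement false true  = refl
disagreement false false = refl

Inf-root : ∀ n (i : Fin n) (L R : DT n) → Valid (node i L R) →
  Inf n i (eval (node i L R)) ≡ ½ + (- ½) * E n (λ x → real (eval L) x * real (eval R) x)
Inf-root n i L R (node ¬iL ¬iR _ _) = begin
  Inf n i f
    ≡⟨ E-condition n i mismatch ⟩
  ½ * (E n (λ x → mismatch (x [ i ]≔ true)) + E n (λ x → mismatch (x [ i ]≔ false)))
    ≡⟨ cong₂ (λ u v → ½ * (u + v)) (E-cong n on-true) (E-cong n on-false) ⟩
  ½ * (E n disagree + E n disagree)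
    ≡⟨ average-self (E n disagree) ⟩
  E n disagree
    ≡⟨ E-affine n ½ (- ½) (λ x → real g x * real h x) ⟩
  ½ + (- ½) * E n (λ x → real g x * real h x) ∎
  where
  open ≡-Reasoning
  f = eval (node i L R)
  g = eval L
  h = eval R
  mismatch : Cube n → ℚ
  mismatch x = if f x xor f (flipAt i x) then 1ℚ else 0ℚ
  disagree : Cube n → ℚ
  disagree x = ½ + (- ½) * (real g x * real h x)
  on-true : ∀ x → mismatch (x [ i ]≔ true) ≡ disagree x
  on-true x
    rewrite flip-fixed i true x | root-true i L R ¬iL x | root-false i L R ¬iR x =
    disagreement (g x) (h x)
  on-false : ∀ x → mismatch (x [ i ]≔ false) ≡ disagree x
  on-false x
    rewrite flip-fixed i false x | root-true i L R ¬iL x | root-false i L R ¬iR x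
          | xor-comm (h x) (g x) =
    disagreement (g x) (h x)

square-nonneg : ∀ p → 0ℚ ≤ p * p
square-nonneg p with ℚP.≤-total 0ℚ p
... | inj₁ 0≤p = let instance _ = nonNegative 0≤p
                              _ = ℚP.nonNeg*nonNeg⇒nonNeg p p
                 in ℚP.nonNegative⁻¹ (p * p)
... | inj₂ p≤0 = let instance _ = nonPositive p≤0
                              _ = ℚP.nonPos*nonPos⇒nonPos p p
                 in ℚP.nonNegative⁻¹ (p * p)

-- With μ = ½(a + b):  ½(1 − μ²) − ½(c − ab) ≤ ½ − ½c,
-- since the difference is ½(μ² − ab) = ½((a − b)/2)² ≥ 0.
mean-square-bound : ∀ a b c → let μ = ½ * (a + b) in
  ½ * (1ℚ - μ * μ) - ½ * (c - a * b) ≤ ½ + (- ½) * c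
mean-square-bound a b c = begin
  lhs                ≡⟨ sym (ℚP.+-identityʳ lhs) ⟩
  lhs + 0ℚ           ≤⟨ ℚP.+-monoʳ-≤ lhs gap-nonneg ⟩
  lhs + ½ * (δ * δ)  ≡⟨ solve 3 (λ a b c →
                          (con ½ :* (con 1ℚ :- (con ½ :* (a :+ b)) :* (con ½ :* (a :+ b))) :- con ½ :* (c :- a :* b))
                          :+ con ½ :* ((con ½ :* (a :- b)) :* (con ½ :* (a :- b)))
                          := con ½ :+ (:- con ½) :* c) refl a b c ⟩
  ½ + (- ½) * c ∎
  where
  open ℚP.≤-Reasoning
  μ = ½ * (a + b)
  lhs = ½ * (1ℚ - μ * μ) - ½ * (c - a * b)
  δ = ½ * (a - b)
  gap-nonneg : 0ℚ ≤ ½ * (δ * δ)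
  gap-nonneg = ℚP.*-monoˡ-≤-nonNeg ½ (square-nonneg δ)

lemma2p6 : (n : ℕ) (i : Fin n) (L R : DT n) → Valid (node i L R) →
    ½ * Var n (eval (node i L R)) - ½ * Cov n (eval L) (eval R)
      ≤ Inf n i (eval (node i L R))
lemma2p6 n i L R valid = begin
  ½ * Var n f - ½ * Cov n g h
    ≡⟨ cong₂ (λ u v → ½ * u - ½ * v) (Var-boolean n f) (E-centred-product n (real g) (real h)) ⟩
  ½ * (1ℚ - E n (real f) * E n (real f)) - ½ * (c - a * b)
    ≡⟨ cong (λ μ → ½ * (1ℚ - μ * μ) - ½ * (c - a * b)) (E-root n i L R valid) ⟩
  ½ * (1ℚ - ½ * (a + b) * (½ * (a + b))) - ½ * (c - a * b)
    ≤⟨ mean-square-bound a b c ⟩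
  ½ + (- ½) * c
    ≡⟨ sym (Inf-root n i L R valid) ⟩
  Inf n i f ∎
  where
  open ℚP.≤-Reasoning
  f = eval (node i L R)
  g = eval L
  h = eval R
  a = E n (real g)
  b = E n (real h)
  c = E n (λ x → real g x * real h x)
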